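{- Let $f$ and $g$ be arithmetic functions that are not identically zero. Let $C(q)$ be a formal power series with nonzero constant term and suppose $(s_{n,k})$ satisfies, for every arithmetic function $a$, \[ \sum_{n \geq 1} \frac{a_n q^n}{1-q^n} = \frac{1}{C(q)} \sum_{n \geq 1} \sum_{k=1}^n s_{n,k}\, a_k\, q^n . \] Then \[ \sum_{n \geq 1} \frac{(f \ast g)(n)\, q^n}{1-q^n} = \frac{1}{C(q)} \sum_{n \geq 1} \sum_{k=1}^n \widetilde{s}_{n,k}(g)\, f(k)\, q^n, \quad\text{where}\quad \widetilde{s}_{n,k}(g) = \sum_{j=1}^n s_{n,kj}\, g(j). \]
   Context: An arithmetic function is a function $\mathbb{Z}_{\geq 1}\to\mathbb{C}$. The Dirichlet convolution is $(f \ast g)(n) := \sum_{d|n} f(d) g(n/d)$. Convention: $s_{n,m} := 0$ for $m > n$. Identities are of formal power series in $q$. -}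

module Defs where

open import Level using (_⊔_)
open import Algebra.Bundles using (CommutativeRing)
open import Data.Nat using (ℕ; zero; suc; _≤?_; _∸_)
open import Data.Nat.Divisibility using (_∣?_)
open import Data.Nat.DivMod using (_/_)
open import Data.Bool using (if_then_else_)
open import Data.Product using (∃-syntax; _×_)
open import Relation.Nullary using (¬_)
open import Relation.Nullary.Decidable using (⌊_⌋)

-- Formal power series over a commutative ring R, represented by their
-- coefficient sequences (index n = coefficient of q^n).
-- Arithmetic functions Z≥1 → R are represented as ℕ → R; the value at 0 is
-- never used.
module Series {c ℓ} (R : CommutativeRing c ℓ) where
  open CommutativeRing R

  PS : Set c
  PS = ℕ → Carrier

  sum1 : ℕ → (ℕ → Carrier) → Carrier
  sum1 zero    f = 0#
  sum1 (suc n) f = sum1 n f + f (suc n)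

  sum0 : ℕ → (ℕ → Carrier) → Carrier
  sum0 zero    f = f 0
  sum0 (suc n) f = sum0 n f + f (suc n)

  _≈ₛ_ : PS → PS → Set ℓ
  A ≈ₛ B = ∀ N → A N ≈ B N

  _⊛_ : PS → PS → PS
  (A ⊛ B) N = sum0 N (λ i → A i * B (N ∸ i))

  oneₛ : PS
  oneₛ zero    = 1#
  oneₛ (suc _) = 0#

  NotIdZero : (ℕ → Carrier) → Set ℓ
  NotIdZero f = ∃[ n ] (¬ (n ≡ℕ 0) × ¬ (f n ≈ 0#))
    where
      open import Relation.Binary.PropositionalEquality using () renaming (_≡_ to _≡ℕ_)

  dconv : (ℕ → Carrier) → (ℕ → Carrier) → ℕ → Carrier
  dconv f g n = sum1 n term
    where
      term : ℕ → Carrier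
      term zero    = 0#
      term (suc k) = if ⌊ suc k ∣? n ⌋ then f (suc k) * g (n / suc k) else 0#

  -- Lambert series  Σ_{n≥1} a_n q^n / (1 - q^n), expanded as a formal power
  -- series:  Σ_{d≥1} Σ_{m≥1} a_d q^{dm}; coefficient of q^N is Σ_{d|N} a_d.
  lambert : (ℕ → Carrier) → PS
  lambert a zero    = 0#
  lambert a (suc N) = sum1 (suc N) (λ d → if ⌊ d ∣? suc N ⌋ then a d else 0#)

  sExt : (ℕ → ℕ → Carrier) → ℕ → ℕ → Carrier
  sExt s n m = if ⌊ m ≤? n ⌋ then s n m else 0#

  factSeries : (ℕ → ℕ → Carrier) → (ℕ → Carrier) → PS
  factSeries s a zero    = 0#
  factSeries s a (suc n) = sum1 (suc n) (λ k → s (suc n) k * a k)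

  stilde : (ℕ → ℕ → Carrier) → (ℕ → Carrier) → ℕ → ℕ → Carrier
  stilde s g n k = sum1 n (λ j → sExt s n (k Data.Nat.* j) * g j)

{-# OPTIONS --safe #-}
-- Applying the hypothesis to a = f ∗ g reduces the claim to the coefficientwise
-- identity  Σ_{m≤N} s_{N,m} (f ∗ g)(m) = Σ_{k≤N} s̃_{N,k}(g) f(k).  Writing
-- (f ∗ g)(m) = Σ_{d,j ≤ N} [m = dj] f(d) g(j), exchanging the order of summation
-- and collapsing the sum over m gives Σ_{d,j} [dj ≤ N] s_{N,dj} f(d) g(j), which is
-- the right-hand side.
module Submission where

open import Defs
open import Algebra.Bundles using (CommutativeRing)
open import Data.Nat using (ℕ)
open import Relation.Nullary using (¬_)

open import Data.Nat as Nat using (zero; suc; _≤_; _<_; s≤s; z≤n; _≟_; _≤?_; _∸_)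
import Data.Nat.Properties as ℕₚ
open import Data.Nat.Divisibility using (divides; ∣⇒≤; _∣?_)
open import Data.Nat.DivMod using (_/_; m*n/n≡m)
open import Data.Bool using (true; false; if_then_else_)
open import Relation.Nullary using (yes; no)
open import Relation.Nullary.Decidable using (⌊_⌋)
open import Relation.Nullary.Negation using (contradiction)
open import Relation.Binary.PropositionalEquality as ≡ using (_≡_; _≢_)
import Algebra.Properties.CommutativeSemigroup as CommutativeSemigroupProperties
import Relation.Binary.Reasoning.Setoid as SetoidReasoning

module FiniteSums {c ℓ} (R : CommutativeRing c ℓ) where
  open CommutativeRing R
  open Series R
  open SetoidReasoning setoid
  open CommutativeSemigroupProperties +-commutativeSemigroup using (interchange)

  sum1-cong : ∀ n {f g : ℕ → Carrier} →
              (∀ i → 1 ≤ i → i ≤ n → f i ≈ g i) → sum1 n f ≈ sum1 n g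
  sum1-cong zero    f≈g = refl
  sum1-cong (suc n) f≈g =
    +-cong (sum1-cong n (λ i 1≤i i≤n → f≈g i 1≤i (ℕₚ.m≤n⇒m≤1+n i≤n)))
           (f≈g (suc n) (s≤s z≤n) ℕₚ.≤-refl)

  sum1-vanishing : ∀ n {f : ℕ → Carrier} →
                   (∀ i → 1 ≤ i → i ≤ n → f i ≈ 0#) → sum1 n f ≈ 0#
  sum1-vanishing zero    f≈0 = refl
  sum1-vanishing (suc n) f≈0 = begin
    sum1 n _ + _ ≈⟨ +-cong (sum1-vanishing n (λ i 1≤i i≤n → f≈0 i 1≤i (ℕₚ.m≤n⇒m≤1+n i≤n)))
                           (f≈0 (suc n) (s≤s z≤n) ℕₚ.≤-refl) ⟩
    0# + 0#      ≈⟨ +-identityʳ 0# ⟩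
    0#           ∎

  sum1-vanishing-tail : ∀ m n {f : ℕ → Carrier} → m ≤ n →
                        (∀ i → m < i → i ≤ n → f i ≈ 0#) → sum1 n f ≈ sum1 m f
  sum1-vanishing-tail m zero    z≤n f≈0 = refl
  sum1-vanishing-tail m (suc n) m≤1+n f≈0 with m ≟ suc n
  ... | yes ≡.refl = refl
  ... | no m≢1+n   = begin
    sum1 n _ + _ ≈⟨ +-cong (sum1-vanishing-tail m n m≤n (λ i m<i i≤n → f≈0 i m<i (ℕₚ.m≤n⇒m≤1+n i≤n)))
                           (f≈0 (suc n) (s≤s m≤n) ℕₚ.≤-refl) ⟩
    sum1 m _ + 0# ≈⟨ +-identityʳ _ ⟩
    sum1 m _      ∎
    where m≤n = ℕₚ.≤-pred (ℕₚ.≤∧≢⇒< m≤1+n m≢1+n)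

  sum0-cong : ∀ n {f g : ℕ → Carrier} → (∀ i → f i ≈ g i) → sum0 n f ≈ sum0 n g
  sum0-cong zero    f≈g = f≈g 0
  sum0-cong (suc n) f≈g = +-cong (sum0-cong n f≈g) (f≈g (suc n))

  ⊛-congˡ : ∀ A {B B′} → B ≈ₛ B′ → (A ⊛ B) ≈ₛ (A ⊛ B′)
  ⊛-congˡ A B≈B′ N = sum0-cong N (λ i → *-cong refl (B≈B′ (N ∸ i)))

  sum1-distrib-+ : ∀ n (f g : ℕ → Carrier) →
                   sum1 n (λ i → f i + g i) ≈ sum1 n f + sum1 n g
  sum1-distrib-+ zero    f g = sym (+-identityʳ 0#)
  sum1-distrib-+ (suc n) f g = trans (+-cong (sum1-distrib-+ n f g) refl) (interchange _ _ _ _)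

  sum1-comm : ∀ m n (t : ℕ → ℕ → Carrier) →
              sum1 m (λ i → sum1 n (t i)) ≈ sum1 n (λ j → sum1 m (λ i → t i j))
  sum1-comm zero    n t = sym (sum1-vanishing n (λ _ _ _ → refl))
  sum1-comm (suc m) n t =
    trans (+-cong (sum1-comm m n t) refl) (sym (sum1-distrib-+ n _ (t (suc m))))

  *-distribˡ-sum1 : ∀ n x (f : ℕ → Carrier) → x * sum1 n f ≈ sum1 n (λ i → x * f i)
  *-distribˡ-sum1 zero    x f = zeroʳ x
  *-distribˡ-sum1 (suc n) x f = trans (distribˡ x _ _) (+-cong (*-distribˡ-sum1 n x f) refl)

  *-distribʳ-sum1 : ∀ n x (f : ℕ → Carrier) → sum1 n f * x ≈ sum1 n (λ i → f i * x)
  *-distribʳ-sum1 zero    x f = zeroˡ x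
  *-distribʳ-sum1 (suc n) x f = trans (distribʳ x _ _) (+-cong (*-distribʳ-sum1 n x f) refl)

  indicator : ℕ → ℕ → (ℕ → Carrier) → Carrier
  indicator i c X = if ⌊ i ≟ c ⌋ then X i else 0#

  indicator-≢ : ∀ {i c} X → i ≢ c → indicator i c X ≈ 0#
  indicator-≢ {i} {c} X i≢c with i ≟ c
  ... | yes i≡c = contradiction i≡c i≢c
  ... | no  _   = refl

  indicator-refl : ∀ c X → indicator c c X ≈ X c
  indicator-refl c X with c ≟ c
  ... | yes _   = refl
  ... | no  c≢c = contradiction ≡.refl c≢c

  sum1-indicator-≤ : ∀ n {c} X → 1 ≤ c → c ≤ n →
                     sum1 n (λ i → indicator i c X) ≈ X c
  sum1-indicator-≤ zero    X (s≤s _) ()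
  sum1-indicator-≤ (suc n) {c} X 1≤c c≤1+n with c ≟ suc n
  ... | yes ≡.refl = begin
    sum1 n _ + indicator (suc n) (suc n) X
      ≈⟨ +-cong (sum1-vanishing n (λ i _ i≤n → indicator-≢ X (ℕₚ.<⇒≢ (s≤s i≤n))))
                (indicator-refl (suc n) X) ⟩
    0# + X (suc n)
      ≈⟨ +-identityˡ _ ⟩
    X (suc n) ∎
  ... | no c≢1+n = begin
    sum1 n _ + indicator (suc n) c X ≈⟨ +-cong (sum1-indicator-≤ n X 1≤c c≤n)
                                             (indicator-≢ X (≡.≢-sym c≢1+n)) ⟩
    X c + 0#                         ≈⟨ +-identityʳ _ ⟩
    X c                              ∎
    where c≤n = ℕₚ.≤-pred (ℕₚ.≤∧≢⇒< c≤1+n c≢1+n)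

  sum1-indicator : ∀ n {c} X → 1 ≤ c →
                   sum1 n (λ i → indicator i c X) ≈ (if ⌊ c ≤? n ⌋ then X c else 0#)
  sum1-indicator n {c} X 1≤c with c ≤? n
  ... | yes c≤n = sum1-indicator-≤ n X 1≤c c≤n
  ... | no  c≰n = sum1-vanishing n (λ i _ i≤n →
                    indicator-≢ X (λ { ≡.refl → c≰n i≤n }))

  *-indicator : ∀ i c (x : ℕ → Carrier) y →
                x i * indicator i c (λ _ → y) ≈ indicator i c (λ i → x i * y)
  *-indicator i c x y with i ≟ c
  ... | yes _ = refl
  ... | no  _ = zeroʳ (x i)

module DirichletConvolution {c ℓ} (R : CommutativeRing c ℓ) (f g : ℕ → CommutativeRing.Carrier R) where
  open CommutativeRing R
  open Series R
  open FiniteSums R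
  open SetoidReasoning setoid

  -- The summand in the definition of dconv, which is local there.
  divisorTerm : ℕ → ℕ → Carrier
  divisorTerm m zero    = 0#
  divisorTerm m (suc k) = if ⌊ suc k ∣? m ⌋ then f (suc k) * g (m / suc k) else 0#

  dconv≈sum1-divisorTerm : ∀ m → dconv f g m ≈ sum1 m (divisorTerm m)
  dconv≈sum1-divisorTerm m = sum1-cong m λ { (suc k) _ _ → refl }

  divisorTerm-> : ∀ {m d} → 1 ≤ m → m < d → divisorTerm m d ≈ 0#
  divisorTerm-> {m} {suc k} 1≤m m<d with suc k ∣? m
  ... | yes d∣m = contradiction (∣⇒≤ ⦃ Nat.>-nonZero 1≤m ⦄ d∣m) (ℕₚ.<⇒≱ m<d)
  ... | no  _   = refl

  divisorTerm≈sum1-indicator : ∀ N {m d} → 1 ≤ m → m ≤ N → 1 ≤ d →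
    divisorTerm m d ≈ sum1 N (λ j → indicator m (d Nat.* j) (λ _ → f d * g j))
  divisorTerm≈sum1-indicator N {m} {suc k} 1≤m m≤N _ with suc k ∣? m
  ... | yes (divides zero m≡0) = contradiction m≡0 (≡.≢-sym (ℕₚ.<⇒≢ 1≤m))
  ... | yes (divides q@(suc _) m≡q*d) = sym (begin
    sum1 N (λ j → indicator m (d Nat.* j) (λ _ → f d * g j))
      ≈⟨ sum1-cong N (λ j _ _ → reflexive (indicator-reindex j)) ⟩
    sum1 N (λ j → indicator j q (λ j → f d * g j))
      ≈⟨ sum1-indicator-≤ N (λ j → f d * g j) (s≤s z≤n) q≤N ⟩
    f d * g q
      ≈⟨ *-cong refl (reflexive (≡.cong g (≡.sym m/d≡q))) ⟩
    f d * g (m / d) ∎)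
    where
      d = suc k
      m≡d*q = ≡.trans m≡q*d (ℕₚ.*-comm q d)
      m/d≡q : m / d ≡ q
      m/d≡q = ≡.trans (≡.cong (_/ d) m≡q*d) (m*n/n≡m q d)
      q≤N : q ≤ N
      q≤N = ℕₚ.≤-trans (ℕₚ.m≤m*n q d) (ℕₚ.≤-trans (ℕₚ.≤-reflexive (≡.sym m≡q*d)) m≤N)
      indicator-reindex : ∀ j → indicator m (d Nat.* j) (λ _ → f d * g j)
                                ≡ indicator j q (λ j → f d * g j)
      indicator-reindex j with m ≟ d Nat.* j | j ≟ q
      ... | yes _     | yes _   = ≡.refl
      ... | no  _     | no  _   = ≡.refl
      ... | yes m≡d*j | no  j≢q = contradiction (ℕₚ.*-cancelˡ-≡ j q d (≡.trans (≡.sym m≡d*j) m≡d*q)) j≢q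
      ... | no  m≢d*j | yes j≡q = contradiction (≡.trans m≡d*q (≡.cong (d Nat.*_) (≡.sym j≡q))) m≢d*j
  ... | no d∤m = sym (sum1-vanishing N (λ j _ _ → indicator-≢ _ (λ m≡d*j →
                   d∤m (divides j (≡.trans m≡d*j (ℕₚ.*-comm (suc k) j))))))

  dconv-expansion : ∀ N {m} → 1 ≤ m → m ≤ N →
    dconv f g m ≈ sum1 N (λ d → sum1 N (λ j → indicator m (d Nat.* j) (λ _ → f d * g j)))
  dconv-expansion N {m} 1≤m m≤N = begin
    dconv f g m
      ≈⟨ dconv≈sum1-divisorTerm m ⟩
    sum1 m (divisorTerm m)
      ≈⟨ sym (sum1-vanishing-tail m N m≤N (λ _ m<d _ → divisorTerm-> 1≤m m<d)) ⟩
    sum1 N (divisorTerm m)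
      ≈⟨ sum1-cong N (λ _ 1≤d _ → divisorTerm≈sum1-indicator N 1≤m m≤N 1≤d) ⟩
    sum1 N (λ d → sum1 N (λ j → indicator m (d Nat.* j) (λ _ → f d * g j))) ∎

  factSeries-dconv-coefficient : ∀ s N →
    sum1 N (λ m → s N m * dconv f g m) ≈ sum1 N (λ k → stilde s g N k * f k)
  factSeries-dconv-coefficient s N = begin
    sum1 N (λ m → s N m * dconv f g m)
      ≈⟨ sum1-cong N (λ m 1≤m m≤N → scale-expansion m (dconv-expansion N 1≤m m≤N)) ⟩
    sum1 N (λ m → sum1 N (λ d → sum1 N (λ j → term m d j)))
      ≈⟨ sum1-comm N N _ ⟩
    sum1 N (λ d → sum1 N (λ m → sum1 N (λ j → term m d j)))
      ≈⟨ sum1-cong N (λ d _ _ → sum1-comm N N _) ⟩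
    sum1 N (λ d → sum1 N (λ j → sum1 N (λ m → term m d j)))
      ≈⟨ sum1-cong N (λ d 1≤d _ → sum1-cong N (λ j 1≤j _ →
           sum1-indicator N _ (ℕₚ.*-mono-≤ 1≤d 1≤j))) ⟩
    sum1 N (λ d → sum1 N (λ j → if ⌊ d Nat.* j ≤? N ⌋ then s N (d Nat.* j) * (f d * g j) else 0#))
      ≈⟨ sum1-cong N (λ k _ _ → sym (trans (*-distribʳ-sum1 N (f k) _)
           (sum1-cong N (λ j _ _ → reassociate ⌊ k Nat.* j ≤? N ⌋)))) ⟩
    sum1 N (λ k → stilde s g N k * f k) ∎
    where
      term : ℕ → ℕ → ℕ → Carrier
      term m d j = indicator m (d Nat.* j) (λ m → s N m * (f d * g j))

      scale-expansion : ∀ m {x} → x ≈ sum1 N (λ d → sum1 N (λ j → indicator m (d Nat.* j) (λ _ → f d * g j))) →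
              s N m * x ≈ sum1 N (λ d → sum1 N (λ j → term m d j))
      scale-expansion m {x} x≈ = begin
        s N m * x
          ≈⟨ *-cong refl x≈ ⟩
        s N m * sum1 N _
          ≈⟨ *-distribˡ-sum1 N (s N m) _ ⟩
        sum1 N (λ d → s N m * sum1 N _)
          ≈⟨ sum1-cong N (λ d _ _ → *-distribˡ-sum1 N (s N m) _) ⟩
        sum1 N (λ d → sum1 N (λ j → s N m * indicator m (d Nat.* j) (λ _ → f d * g j)))
          ≈⟨ sum1-cong N (λ d _ _ → sum1-cong N (λ j _ _ → *-indicator m (d Nat.* j) (s N) (f d * g j))) ⟩
        sum1 N (λ d → sum1 N (λ j → term m d j)) ∎

      reassociate : ∀ {k j} b → ((if b then s N (k Nat.* j) else 0#) * g j) * f k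
                                ≈ (if b then s N (k Nat.* j) * (f k * g j) else 0#)
      reassociate {k} {j} true  = trans (*-assoc _ (g j) (f k)) (*-cong refl (*-comm (g j) (f k)))
      reassociate {k} {j} false = trans (*-cong (zeroˡ (g j)) refl) (zeroˡ (f k))

  factSeries-dconv : ∀ s → factSeries s (dconv f g) ≈ₛ factSeries (stilde s g) f
  factSeries-dconv s zero    = refl
  factSeries-dconv s (suc n) = factSeries-dconv-coefficient s (suc n)

proposition4p1 : ∀ {c ℓ} (R : CommutativeRing c ℓ) →
    let open CommutativeRing R
        open Series R
    in (f g : ℕ → Carrier) → NotIdZero f → NotIdZero g →
       (C Cinv : PS) → ¬ (C 0 ≈ 0#) → (C ⊛ Cinv) ≈ₛ oneₛ →
       (s : ℕ → ℕ → Carrier) →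
       (∀ (a : ℕ → Carrier) → lambert a ≈ₛ (Cinv ⊛ factSeries s a)) →
       lambert (dconv f g) ≈ₛ (Cinv ⊛ factSeries (stilde s g) f)
proposition4p1 R f g _ _ _ Cinv _ _ s lambert-expansion N =
  trans (lambert-expansion (dconv f g) N) (⊛-congˡ Cinv (factSeries-dconv s) N)
  where
    open CommutativeRing R
    open Series R
    open FiniteSums R
    open DirichletConvolution R f g
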